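{- Let $T$ be a correlation-free parity decision tree over $\{ -1,1\}^n$ of depth $d$. Then $$\mathbf{E}_{\ell\in T}\Big(\sum_{i=1}^n \ell_i\Big)^2 \le d.$$
   Context: A parity decision tree over $\{ -1,1\}^n$ is a rooted full binary tree in which each internal node is labelled by a set $S\subseteq[n]$ and its two outgoing edges are labelled $-1$ and $1$; an input $x\in\{ -1,1\}^n$ follows, at a node labelled $S$, the edge labelled $\prod_{i\in S}x_i$, reaching a unique leaf. Depth is the maximum number of internal nodes on a root-to-leaf path. A quantity (such as $x_i$ or $x_i\oplus x_j$, i.e. $x_ix_j$) is fixed by the queries on a path if it takes the same value on all inputs following that path. $T$ is (pairwise) correlation-free if for every $i\ne j\in[n]$ and every path from the root in $T$, whenever $x_i\oplus x_j$ is fixed by the queries on the path, so are $x_i$ and $x_j$. Each leaf is represented by the vector $\ell\in\{ -1,0,1\}^n$ where $\ell_i$ is the average of $x_i$ over inputs reaching that leaf; $\mathbf{E}_{\ell\in T}$ is over the leaf reached by a uniformly random $x\in\{ -1,1\}^n$. -}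

module Defs where

open import Data.Bool using (Bool; true; false; if_then_else_)
open import Data.Nat as ℕ using (ℕ; zero; suc)
open import Data.Integer as ℤ using (ℤ; +_; -[1+_])
open import Data.Rational as ℚ using (ℚ; 0ℚ; _/_)
open import Data.Fin using (Fin)
open import Data.Fin.Subset using (Subset)
open import Data.Vec as Vec using (Vec; []; _∷_; lookup; tabulate)
open import Data.List as List using (List; []; _∷_; [_]; length; filter; concatMap; map)
open import Data.List.Relation.Unary.All as All using (All)
open import Data.Product using (_×_; _,_; proj₁; proj₂)
open import Relation.Binary.PropositionalEquality using (_≡_; _≢_)
open import Relation.Nullary using (¬_)

-- An input in {-1,1}^n, encoded as a vector of Booleans: true ↦ +1, false ↦ -1.
Cube : ℕ → Set
Cube n = Vec Bool n

val : Bool → ℤ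
val true  = + 1
val false = -[1+ 0 ]

coord : ∀ {n} → Fin n → Cube n → ℤ
coord i x = val (lookup x i)

chi : ∀ {n} → Subset n → Cube n → ℤ
chi []      []      = + 1
chi (s ∷ S) (b ∷ x) = (if s then val b else + 1) ℤ.* chi S x

allCubes : (n : ℕ) → List (Cube n)
allCubes zero    = [ [] ]
allCubes (suc n) = concatMap (λ x → (true ∷ x) ∷ (false ∷ x) ∷ []) (allCubes n)

-- Parity decision tree: node S t₋ t₊, where t₋ is the child along edge -1
-- and t₊ the child along edge 1.
data PDT (n : ℕ) : Set where
  leaf : PDT n
  node : Subset n → PDT n → PDT n → PDT n

depth : ∀ {n} → PDT n → ℕ
depth leaf           = 0
depth (node _ t₋ t₊) = suc (depth t₋ ℕ.⊔ depth t₊)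

-- A path from the root is recorded as the list of queries with their answers.
Query : ℕ → Set
Query n = Subset n × ℤ

data IsPath {n : ℕ} : PDT n → List (Query n) → Set where
  here  : ∀ {t} → IsPath t []
  left  : ∀ {S t₋ t₊ p} → IsPath t₋ p → IsPath (node S t₋ t₊) ((S , -[1+ 0 ]) ∷ p)
  right : ∀ {S t₋ t₊ p} → IsPath t₊ p → IsPath (node S t₋ t₊) ((S , + 1) ∷ p)

Follows : ∀ {n} → Cube n → List (Query n) → Set
Follows x p = All (λ q → chi (proj₁ q) x ≡ proj₂ q) p

follows? : ∀ {n} (p : List (Query n)) (x : Cube n) → Relation.Nullary.Dec (Follows x p)
follows? p x = All.all? (λ q → chi (proj₁ q) x ℤ.≟ proj₂ q) p

Fixed : ∀ {n} → (Cube n → ℤ) → List (Query n) → Set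
Fixed f p = ∀ x y → Follows x p → Follows y p → f x ≡ f y

CorrelationFree : ∀ {n} → PDT n → Set
CorrelationFree {n} T =
  ∀ (i j : Fin n) → i ≢ j → ∀ p → IsPath T p →
  Fixed (λ x → coord i x ℤ.* coord j x) p →
  Fixed (coord i) p × Fixed (coord j) p

pathOf : ∀ {n} → PDT n → Cube n → List (Query n)
pathOf leaf           x = []
pathOf (node S t₋ t₊) x with chi S x ℤ.≟ -[1+ 0 ]
... | Relation.Nullary.yes _ = (S , -[1+ 0 ]) ∷ pathOf t₋ x
... | Relation.Nullary.no  _ = (S , + 1) ∷ pathOf t₊ x

sumℚ : List ℚ → ℚ
sumℚ = List.foldr ℚ._+_ 0ℚ

-- average of a list of rationals (0 for the empty list, never used)
avg : List ℚ → ℚ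
avg []       = 0ℚ
avg (q ∷ qs) = sumℚ (q ∷ qs) ℚ.* (+ 1 / suc (length qs))

inputsOn : ∀ {n} → List (Query n) → List (Cube n)
inputsOn {n} p = filter (follows? p) (allCubes n)

-- the leaf vector ℓ reached by x: ℓ_i = average of y_i over inputs y reaching that leaf
leafVec : ∀ {n} → PDT n → Cube n → Vec ℚ n
leafVec T x = tabulate (λ i → avg (map (λ y → coord i y / 1) (inputsOn (pathOf T x))))

expSqSum : ∀ {n} → PDT n → ℚ
expSqSum {n} T = avg (map (λ x → let s = Vec.foldr _ ℚ._+_ 0ℚ (leafVec T x) in s ℚ.* s) (allCubes n))

module Submission where

-- For a path p (a list of answered queries) let N p be the number of inputs following p,
-- c p i the average of x_i over them and G p = Σ_i c p i.  The followers of p form a coset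
-- of a subgroup of the cube, so each coordinate is either constant on them or balanced:
-- c p i ∈ {-1, 0, 1}, and G p is the coordinate sum of the leaf vector when p ends at a leaf.
-- Splitting p by a query into children p₋ and p₊ we show
--   (1) N p · G p = N p₋ · G p₋ + N p₊ · G p₊                      (G is a martingale);
--   (2) if T is correlation-free, one query fixes at most one new coordinate, so
--       (G p± − G p)² ≤ 1 whenever p± has a follower;
--   (3) hence, by the parallel-axis identity, N p₋ G p₋² + N p₊ G p₊² ≤ N p (G p² + 1).
-- Summing (3) down the tree bounds the energy Σ_x G(path of x)² by 2ⁿ (G(root)² + d), and
-- G(root) = 0.  The file develops, in order: signs and the group structure of the cube, sums
-- over the cube, the values c p i, the splitting identities, (1)–(3), the energy recursion over
-- the tree, and finally the transfer from integer sums to the rational average `expSqSum`.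

open import Defs
open import Data.Nat using (ℕ)
open import Data.Integer using (+_)
open import Data.Rational using (_≤_; _/_)
open import Relation.Binary.PropositionalEquality using (_≡_)

open import Data.Bool using (Bool; true; false; not; if_then_else_)
open import Data.Bool.Properties using (¬-not; not-¬)
open import Data.Nat as ℕ using (zero; suc)
import Data.Nat.Properties as ℕP
open import Data.Integer as ℤ using (ℤ; -[1+_])
import Data.Integer.Properties as ℤP
open import Data.Integer.Solver using (module +-*-Solver)
open import Data.Rational as ℚ using (ℚ; 0ℚ; toℚᵘ)
import Data.Rational.Properties as ℚP
open import Data.Rational.Unnormalised as ℚᵘ using (mkℚᵘ; *≡*; *≤*)
import Data.Rational.Unnormalised.Properties as ℚᵘP
open import Data.Fin using (Fin; zero; suc)
import Data.Fin.Properties as FinP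
open import Data.Fin.Subset using (Subset)
open import Data.Vec as Vec using ([]; _∷_; lookup; zipWith; replicate)
import Data.Vec.Properties as VecP
open import Data.Vec.Functional using (Vector)
open import Data.List as List using (List; []; _∷_; [_]; filter; length; map; concatMap; _++_)
import Data.List.Properties as ListP
open import Data.List.Relation.Unary.All as All using ([]; _∷_)
import Data.List.Relation.Unary.All.Properties as AllP
open import Data.Product using (Σ; _×_; _,_; proj₁)
open import Data.Sum using (_⊎_; inj₁; inj₂)
open import Data.Empty using (⊥; ⊥-elim)
open import Function using (_∘_)
open import Relation.Nullary using (¬_; Dec; yes; no; does)
open import Relation.Nullary.Decidable using (_×-dec_)
open import Relation.Binary.PropositionalEquality
  using (_≢_; refl; sym; trans; cong; cong₂; subst; module ≡-Reasoning)
open import Algebra.Properties.Semiring.Sum ℤP.+-*-semiring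
  using (sum; sum-cong-≗; ∑-distrib-+; *-distribˡ-sum; sum-replicate-zero)

open +-*-Solver

private
  variable
    n : ℕ
    a : Bool
    v w x : Cube n

-- Signs: the cube {-1,1}ⁿ is a group under pointwise multiplication, the parities χ_S
-- are its characters, and the followers of a path form a coset.

PM : ℤ → Set
PM k = k ≡ + 1 ⊎ k ≡ -[1+ 0 ]

val-pm : ∀ a → PM (val a)
val-pm true  = inj₁ refl
val-pm false = inj₂ refl

pm-* : ∀ {k l} → PM k → PM l → PM (k ℤ.* l)
pm-* (inj₁ refl) (inj₁ refl) = inj₁ refl
pm-* (inj₁ refl) (inj₂ refl) = inj₂ refl
pm-* (inj₂ refl) (inj₁ refl) = inj₂ refl
pm-* (inj₂ refl) (inj₂ refl) = inj₁ refl

chi-pm : (S : Subset n) (x : Cube n) → PM (chi S x)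
chi-pm []          []      = inj₁ refl
chi-pm (true ∷ S)  (b ∷ x) = pm-* (val-pm b) (chi-pm S x)
chi-pm (false ∷ S) (b ∷ x) = pm-* (inj₁ refl) (chi-pm S x)

pm-square : ∀ {k} → PM k → k ℤ.* k ≡ + 1
pm-square (inj₁ refl) = refl
pm-square (inj₂ refl) = refl

pm-other : ∀ {k l m} → PM k → PM l → PM m → k ≢ m → l ≢ m → k ≡ l
pm-other (inj₁ refl) (inj₁ refl) _           _   _   = refl
pm-other (inj₂ refl) (inj₂ refl) _           _   _   = refl
pm-other (inj₁ refl) (inj₂ refl) (inj₁ refl) k≢m _   = ⊥-elim (k≢m refl)
pm-other (inj₁ refl) (inj₂ refl) (inj₂ refl) _   l≢m = ⊥-elim (l≢m refl)
pm-other (inj₂ refl) (inj₁ refl) (inj₁ refl) _   l≢m = ⊥-elim (l≢m refl)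
pm-other (inj₂ refl) (inj₁ refl) (inj₂ refl) k≢m _   = ⊥-elim (k≢m refl)

-- Multiplication of signs in the Boolean encoding (true ↦ 1).
_⊙_ : Bool → Bool → Bool
true  ⊙ b = b
false ⊙ b = not b

val-⊙ : ∀ a b → val (a ⊙ b) ≡ val a ℤ.* val b
val-⊙ true  true  = refl
val-⊙ true  false = refl
val-⊙ false true  = refl
val-⊙ false false = refl

⊙-cancelʳ : ∀ a b → (a ⊙ b) ⊙ b ≡ a
⊙-cancelʳ true  true  = refl
⊙-cancelʳ true  false = refl
⊙-cancelʳ false true  = refl
⊙-cancelʳ false false = refl

⊙-cancel : ∀ v m a → v ⊙ (m ⊙ a) ≡ a → v ≡ m
⊙-cancel true  true  _     _  = refl
⊙-cancel false false _     _  = refl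
⊙-cancel true  false true  ()
⊙-cancel true  false false ()
⊙-cancel false true  true  ()
⊙-cancel false true  false ()

infixl 7 _·_
_·_ : Cube n → Cube n → Cube n
_·_ = zipWith _⊙_

lookup-· : (x y : Cube n) (i : Fin n) → lookup (x · y) i ≡ lookup x i ⊙ lookup y i
lookup-· x y i = VecP.lookup-zipWith _⊙_ i x y

·-cancelʳ : (x c : Cube n) → (x · c) · c ≡ x
·-cancelʳ []      []      = refl
·-cancelʳ (a ∷ x) (b ∷ c) = cong₂ _∷_ (⊙-cancelʳ a b) (·-cancelʳ x c)

chi-· : (S : Subset n) (x y : Cube n) → chi S (x · y) ≡ chi S x ℤ.* chi S y
chi-· []          []      []      = refl
chi-· (true ∷ S)  (a ∷ x) (b ∷ y) rewrite val-⊙ a b | chi-· S x y =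
  solve 4 (λ a b c d → (a :* b) :* (c :* d) := (a :* c) :* (b :* d)) refl
    (val a) (val b) (chi S x) (chi S y)
chi-· (false ∷ S) (a ∷ x) (b ∷ y) rewrite chi-· S x y =
  solve 2 (λ c d → con (+ 1) :* (c :* d) := (con (+ 1) :* c) :* (con (+ 1) :* d)) refl
    (chi S x) (chi S y)

chi-same-side : (S : Subset n) (v w u : Cube n) → chi S v ≡ chi S w →
  chi S (v · (w · u)) ≡ chi S u
chi-same-side S v w u e = begin
  chi S (v · (w · u))               ≡⟨ chi-· S v (w · u) ⟩
  χv ℤ.* chi S (w · u)              ≡⟨ cong (χv ℤ.*_) (chi-· S w u) ⟩
  χv ℤ.* (chi S w ℤ.* chi S u)      ≡⟨ cong (λ t → χv ℤ.* (t ℤ.* chi S u)) (sym e) ⟩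
  χv ℤ.* (χv ℤ.* chi S u)           ≡⟨ sym (ℤP.*-assoc χv χv (chi S u)) ⟩
  (χv ℤ.* χv) ℤ.* chi S u           ≡⟨ cong (ℤ._* chi S u) (pm-square (chi-pm S v)) ⟩
  + 1 ℤ.* chi S u                   ≡⟨ ℤP.*-identityˡ (chi S u) ⟩
  chi S u                           ∎
  where
  open ≡-Reasoning
  χv = chi S v

-- The followers of a path form a coset: they are closed under (v, w, u) ↦ v·w·u.
coset : (p : List (Query n)) {v w u : Cube n} → Follows v p → Follows w p → Follows u p →
  Follows (v · (w · u)) p
coset []            []        []        []        = []
coset ((S , _) ∷ p) {v} {w} {u} (ev ∷ fv) (ew ∷ fw) (eu ∷ fu) =
  trans (chi-same-side S v w u (trans ev (sym ew))) eu ∷ coset p fv fw fu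

sumAll : (Cube n → ℤ) → ℤ
sumAll {zero}  F = F []
sumAll {suc n} F = sumAll (λ x → F (true ∷ x) ℤ.+ F (false ∷ x))

sumAll-cong : {F G : Cube n → ℤ} → (∀ x → F x ≡ G x) → sumAll F ≡ sumAll G
sumAll-cong {zero}  h = h []
sumAll-cong {suc n} h = sumAll-cong {n} (λ x → cong₂ ℤ._+_ (h (true ∷ x)) (h (false ∷ x)))

sumAll-+ : (F G : Cube n → ℤ) → sumAll (λ x → F x ℤ.+ G x) ≡ sumAll F ℤ.+ sumAll G
sumAll-+ {zero}  F G = refl
sumAll-+ {suc n} F G = trans
  (sumAll-cong {n} (λ x → solve 4 (λ a b c d → (a :+ c) :+ (b :+ d) := (a :+ b) :+ (c :+ d)) refl
    (F (true ∷ x)) (F (false ∷ x)) (G (true ∷ x)) (G (false ∷ x))))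
  (sumAll-+ (λ x → F (true ∷ x) ℤ.+ F (false ∷ x)) (λ x → G (true ∷ x) ℤ.+ G (false ∷ x)))

sumAll-*c : (F : Cube n → ℤ) (k : ℤ) → sumAll (λ x → F x ℤ.* k) ≡ sumAll F ℤ.* k
sumAll-*c {zero}  F k = refl
sumAll-*c {suc n} F k = trans
  (sumAll-cong {n} (λ x → sym (ℤP.*-distribʳ-+ k (F (true ∷ x)) (F (false ∷ x)))))
  (sumAll-*c (λ x → F (true ∷ x) ℤ.+ F (false ∷ x)) k)

sumAll-mono : {F G : Cube n → ℤ} → (∀ x → F x ℤ.≤ G x) → sumAll F ℤ.≤ sumAll G
sumAll-mono {zero}  h = h []
sumAll-mono {suc n} h = sumAll-mono {n} (λ x → ℤP.+-mono-≤ (h (true ∷ x)) (h (false ∷ x)))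

sumAll-nonneg : {F : Cube n → ℤ} → (∀ x → + 0 ℤ.≤ F x) → + 0 ℤ.≤ sumAll F
sumAll-nonneg {zero}  h = h []
sumAll-nonneg {suc n} h = sumAll-nonneg {n} (λ x → ℤP.+-mono-≤ (h (true ∷ x)) (h (false ∷ x)))

sumAll-point : (F : Cube n → ℤ) → (∀ x → + 0 ℤ.≤ F x) → ∀ x → F x ℤ.≤ sumAll F
sumAll-point {zero}  F h [] = ℤP.≤-refl
sumAll-point {suc n} F h (true ∷ x) = ℤP.≤-trans
  (ℤP.i≤i+j (F (true ∷ x)) (F (false ∷ x)) {{ℤ.nonNegative (h (false ∷ x))}})
  (sumAll-point _ (λ y → ℤP.+-mono-≤ (h (true ∷ y)) (h (false ∷ y))) x)
sumAll-point {suc n} F h (false ∷ x) = ℤP.≤-trans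
  (ℤP.i≤j+i (F (false ∷ x)) (F (true ∷ x)) {{ℤ.nonNegative (h (true ∷ x))}})
  (sumAll-point _ (λ y → ℤP.+-mono-≤ (h (true ∷ y)) (h (false ∷ y))) x)

sumAll-shift : (F : Cube n → ℤ) (c : Cube n) → sumAll (λ x → F (x · c)) ≡ sumAll F
sumAll-shift {zero}  F []          = refl
sumAll-shift {suc n} F (true ∷ c)  = sumAll-shift (λ x → F (true ∷ x) ℤ.+ F (false ∷ x)) c
sumAll-shift {suc n} F (false ∷ c) = trans
  (sumAll-shift (λ x → F (false ∷ x) ℤ.+ F (true ∷ x)) c)
  (sumAll-cong {n} (λ x → ℤP.+-comm (F (false ∷ x)) (F (true ∷ x))))

search : (P : Cube n → Set) → (∀ x → Dec (P x)) → Σ (Cube n) P ⊎ (∀ x → ¬ P x)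
search {zero} P P? with P? []
... | yes px = inj₁ ([] , px)
... | no ¬px = inj₂ (λ { [] → ¬px })
search {suc n} P P? with search (P ∘ (true ∷_)) (P? ∘ (true ∷_))
... | inj₁ (x , px) = inj₁ (true ∷ x , px)
... | inj₂ noTrue with search (P ∘ (false ∷_)) (P? ∘ (false ∷_))
...   | inj₁ (x , px) = inj₁ (false ∷ x , px)
...   | inj₂ noFalse  = inj₂ (λ { (true ∷ x) → noTrue x ; (false ∷ x) → noFalse x })

ind : List (Query n) → Cube n → ℤ
ind p x = if does (follows? p x) then + 1 else + 0

ind-yes : (p : List (Query n)) (x : Cube n) → Follows x p → ind p x ≡ + 1
ind-yes p x f with follows? p x
... | yes _  = refl
... | no ¬f  = ⊥-elim (¬f f)

ind-no : (p : List (Query n)) (x : Cube n) → ¬ Follows x p → ind p x ≡ + 0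
ind-no p x ¬f with follows? p x
... | yes f = ⊥-elim (¬f f)
... | no _  = refl

ind-nonneg : (p : List (Query n)) (x : Cube n) → + 0 ℤ.≤ ind p x
ind-nonneg p x with follows? p x
... | yes _ = ℤ.+≤+ ℕ.z≤n
... | no _  = ℤ.+≤+ ℕ.z≤n

N : List (Query n) → ℤ
N p = sumAll (ind p)

N-nonneg : (p : List (Query n)) → + 0 ℤ.≤ N p
N-nonneg p = sumAll-nonneg (ind-nonneg p)

N-positive : (p : List (Query n)) (x : Cube n) → Follows x p → + 1 ℤ.≤ N p
N-positive p x f = subst (ℤ._≤ N p) (ind-yes p x f) (sumAll-point (ind p) (ind-nonneg p) x)

Sc : List (Query n) → Fin n → ℤ
Sc p i = sumAll (λ x → ind p x ℤ.* coord i x)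

sum-on-cong : (p : List (Query n)) {F G : Cube n → ℤ} → (∀ y → Follows y p → F y ≡ G y) →
  sumAll (λ x → ind p x ℤ.* F x) ≡ sumAll (λ x → ind p x ℤ.* G x)
sum-on-cong p {F} {G} h = sumAll-cong pointwise
  where
  pointwise : ∀ x → ind p x ℤ.* F x ≡ ind p x ℤ.* G x
  pointwise x with follows? p x
  ... | yes f = cong (+ 1 ℤ.*_) (h x f)
  ... | no _  = refl

sum-on-mono : (p : List (Query n)) {F G : Cube n → ℤ} → (∀ y → Follows y p → F y ℤ.≤ G y) →
  sumAll (λ x → ind p x ℤ.* F x) ℤ.≤ sumAll (λ x → ind p x ℤ.* G x)
sum-on-mono p {F} {G} h = sumAll-mono pointwise
  where
  pointwise : ∀ x → ind p x ℤ.* F x ℤ.≤ ind p x ℤ.* G x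
  pointwise x with follows? p x
  ... | yes f = ℤP.*-monoˡ-≤-nonNeg (+ 1) (h x f)
  ... | no _  = ℤP.≤-refl

N-weighted-bound : (p : List (Query n)) (s : ℤ) → (∀ y → Follows y p → s ℤ.≤ + 1) →
  N p ℤ.* s ℤ.≤ N p
N-weighted-bound p s h = begin
  N p ℤ.* s                          ≡⟨ sym (sumAll-*c (ind p) s) ⟩
  sumAll (λ x → ind p x ℤ.* s)       ≤⟨ sum-on-mono p h ⟩
  sumAll (λ x → ind p x ℤ.* + 1)     ≡⟨ sumAll-cong (λ x → ℤP.*-identityʳ (ind p x)) ⟩
  N p                                ∎
  where open ℤP.≤-Reasoning

-- The value of a coordinate on a path: constant (±1) or balanced (average 0).

ConstOn : List (Query n) → Fin n → Bool → Set
ConstOn {n} p i a = ∀ (y : Cube n) → Follows y p → lookup y i ≡ a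

Attains : List (Query n) → Fin n → Bool → Set
Attains {n} p i a = Σ (Cube n) λ y → Follows y p × lookup y i ≡ a

Mixed : List (Query n) → Fin n → Set
Mixed p i = ∀ a → Attains p i a

mixed-not-const : (p : List (Query n)) (i : Fin n) → Mixed p i → ¬ ConstOn p i a
mixed-not-const {a = a} p i m h with m (not a)
... | y , fy , ey = not-¬ refl (trans (sym (h y fy)) ey)

attains? : (p : List (Query n)) (i : Fin n) (a : Bool) → Attains p i a ⊎ ConstOn p i (not a)
attains? p i a with search (λ y → Follows y p × lookup y i ≡ a)
                            (λ y → follows? p y ×-dec (lookup y i Data.Bool.≟ a))
... | inj₁ witness = inj₁ witness
... | inj₂ none    = inj₂ (λ y fy → ¬-not (λ e → none y (fy , e)))

data View (p : List (Query n)) (i : Fin n) : Set where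
  const : ∀ a → ConstOn p i a → View p i
  mixed : Mixed p i → View p i

view : (p : List (Query n)) (i : Fin n) → View p i
view p i with attains? p i false
... | inj₂ allTrue = const true allTrue
... | inj₁ zf with attains? p i true
...   | inj₂ allFalse = const false allFalse
...   | inj₁ yt       = mixed (λ { true → yt ; false → zf })

cval : {p : List (Query n)} {i : Fin n} → View p i → ℤ
cval (const a _) = val a
cval (mixed _)   = + 0

-- c p i = average of x_i over the followers of p (see `Sc≡N*c`)
c : List (Query n) → Fin n → ℤ
c p i = cval (view p i)

cval-const : (p : List (Query n)) (i : Fin n) → ConstOn p i a → Follows x p →
  (w : View p i) → cval w ≡ val a
cval-const {x = x} p i h f (const a' h') = cong val (trans (sym (h' x f)) (h x f))
cval-const p i h f (mixed m)             = ⊥-elim (mixed-not-const p i m h)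

cval-mixed : (p : List (Query n)) (i : Fin n) → Mixed p i → (w : View p i) → cval w ≡ + 0
cval-mixed p i m (const a h) = ⊥-elim (mixed-not-const p i m h)
cval-mixed p i m (mixed _)   = refl

ind-shift : (p : List (Query n)) → Follows v p → Follows w p → ∀ x → ind p (x · (v · w)) ≡ ind p x
ind-shift {v = v} {w = w} p fv fw x with follows? p x
... | yes fx = ind-yes p _ (coset p fx fv fw)
... | no ¬fx = ind-no p _ (λ f → ¬fx (subst (λ r → Follows r p) (·-cancelʳ x (v · w)) (coset p f fv fw)))

self-negating : ∀ k → k ≡ k ℤ.* -[1+ 0 ] → k ≡ + 0
self-negating (+ zero)  _  = refl
self-negating (+ suc m) ()
self-negating -[1+ m ]  ()

-- A mixed coordinate is balanced on the followers of p: translating by y·z, where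
-- y_i = 1 and z_i = -1, negates x_i and preserves the followers.
mixed-balanced : (p : List (Query n)) (i : Fin n) → Mixed p i → Sc p i ≡ + 0
mixed-balanced p i m with m true | m false
... | y , fy , yi | z , fz , zi = self-negating (Sc p i) (begin
  Sc p i                                                  ≡⟨ sym (sumAll-shift _ t) ⟩
  sumAll (λ x → ind p (x · t) ℤ.* coord i (x · t))        ≡⟨ sumAll-cong flip ⟩
  sumAll (λ x → ind p x ℤ.* coord i x ℤ.* -[1+ 0 ])       ≡⟨ sumAll-*c (λ x → ind p x ℤ.* coord i x) -[1+ 0 ] ⟩
  Sc p i ℤ.* -[1+ 0 ]                                     ∎)
  where
  open ≡-Reasoning
  t = y · z
  coord-flip : ∀ x → coord i (x · t) ≡ coord i x ℤ.* -[1+ 0 ]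
  coord-flip x rewrite lookup-· x t i | lookup-· y z i | yi | zi with lookup x i
  ... | true  = refl
  ... | false = refl
  flip : ∀ x → ind p (x · t) ℤ.* coord i (x · t) ≡ ind p x ℤ.* coord i x ℤ.* -[1+ 0 ]
  flip x = trans (cong₂ ℤ._*_ (ind-shift p fy fz x) (coord-flip x))
                 (sym (ℤP.*-assoc (ind p x) (coord i x) -[1+ 0 ]))

Sc-value : (p : List (Query n)) (i : Fin n) (w : View p i) → Sc p i ≡ N p ℤ.* cval w
Sc-value p i (const a h) = trans (sum-on-cong p (λ y fy → cong val (h y fy))) (sumAll-*c (ind p) (val a))
Sc-value p i (mixed m)   = trans (mixed-balanced p i m) (sym (ℤP.*-zeroʳ (N p)))

Sc≡N*c : (p : List (Query n)) (i : Fin n) → Sc p i ≡ N p ℤ.* c p i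
Sc≡N*c p i = Sc-value p i (view p i)

extend : List (Query n) → Subset n → ℤ → List (Query n)
extend p S v = p ++ [ S , v ]

follows-extend : (p : List (Query n)) (S : Subset n) (v : ℤ) → Follows x p → chi S x ≡ v →
  Follows x (extend p S v)
follows-extend p S v f e = AllP.++⁺ f (e ∷ [])

follows-prefix : (p : List (Query n)) (S : Subset n) (v : ℤ) → Follows x (extend p S v) → Follows x p
follows-prefix p S v f = AllP.++⁻ˡ p f

follows-answer : (p : List (Query n)) (S : Subset n) (v : ℤ) → Follows x (extend p S v) → chi S x ≡ v
follows-answer p S v f with AllP.++⁻ʳ p f
... | e ∷ [] = e

ind-extend-yes : (p : List (Query n)) (S : Subset n) (v : ℤ) (x : Cube n) → chi S x ≡ v →
  ind (extend p S v) x ≡ ind p x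
ind-extend-yes p S v x e with follows? p x
... | yes f  = ind-yes (extend p S v) x (follows-extend p S v f e)
... | no ¬f  = ind-no (extend p S v) x (¬f ∘ follows-prefix p S v)

ind-extend-no : (p : List (Query n)) (S : Subset n) (v : ℤ) (x : Cube n) → chi S x ≢ v →
  ind (extend p S v) x ≡ + 0
ind-extend-no p S v x ne = ind-no (extend p S v) x (ne ∘ follows-answer p S v)

-1≢1 : -[1+ 0 ] ≢ + 1
-1≢1 ()

ind-split : (p : List (Query n)) (S : Subset n) (x : Cube n) →
  ind p x ≡ ind (extend p S -[1+ 0 ]) x ℤ.+ ind (extend p S (+ 1)) x
ind-split p S x with chi-pm S x
... | inj₁ e rewrite ind-extend-yes p S (+ 1) x e
                   | ind-extend-no p S -[1+ 0 ] x (λ e' → -1≢1 (trans (sym e') e)) =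
  sym (ℤP.+-identityˡ (ind p x))
... | inj₂ e rewrite ind-extend-yes p S -[1+ 0 ] x e
                   | ind-extend-no p S (+ 1) x (λ e' → -1≢1 (trans (sym e) e')) =
  sym (ℤP.+-identityʳ (ind p x))

N-split : (p : List (Query n)) (S : Subset n) →
  N p ≡ N (extend p S -[1+ 0 ]) ℤ.+ N (extend p S (+ 1))
N-split p S = trans (sumAll-cong (ind-split p S))
  (sumAll-+ (ind (extend p S -[1+ 0 ])) (ind (extend p S (+ 1))))

Sc-split : (p : List (Query n)) (S : Subset n) (i : Fin n) →
  Sc p i ≡ Sc (extend p S -[1+ 0 ]) i ℤ.+ Sc (extend p S (+ 1)) i
Sc-split p S i = trans
  (sumAll-cong (λ x → trans (cong (ℤ._* coord i x) (ind-split p S x))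
                            (ℤP.*-distribʳ-+ (coord i x) (ind (extend p S -[1+ 0 ]) x) (ind (extend p S (+ 1)) x))))
  (sumAll-+ (λ x → ind (extend p S -[1+ 0 ]) x ℤ.* coord i x) (λ x → ind (extend p S (+ 1)) x ℤ.* coord i x))

G : List (Query n) → ℤ
G p = sum (c p)

N*G≡ΣSc : (p : List (Query n)) → N p ℤ.* G p ≡ sum (Sc p)
N*G≡ΣSc p = trans (*-distribˡ-sum (N p) (c p)) (sum-cong-≗ (sym ∘ Sc≡N*c p))

G-martingale : (p : List (Query n)) (S : Subset n) →
  N p ℤ.* G p ≡ N (extend p S -[1+ 0 ]) ℤ.* G (extend p S -[1+ 0 ])
                ℤ.+ N (extend p S (+ 1)) ℤ.* G (extend p S (+ 1))
G-martingale p S = begin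
  N p ℤ.* G p                          ≡⟨ N*G≡ΣSc p ⟩
  sum (Sc p)                           ≡⟨ sum-cong-≗ (Sc-split p S) ⟩
  sum (λ i → Sc p₋ i ℤ.+ Sc p₊ i)      ≡⟨ ∑-distrib-+ (Sc p₋) (Sc p₊) ⟩
  sum (Sc p₋) ℤ.+ sum (Sc p₊)          ≡⟨ sym (cong₂ ℤ._+_ (N*G≡ΣSc p₋) (N*G≡ΣSc p₊)) ⟩
  N p₋ ℤ.* G p₋ ℤ.+ N p₊ ℤ.* G p₊      ∎
  where
  open ≡-Reasoning
  p₋ = extend p S -[1+ 0 ]
  p₊ = extend p S (+ 1)

-- Under correlation-freeness one query fixes at most one new coordinate.

CorrelationFreeAt : List (Query n) → Set
CorrelationFreeAt {n} p = ∀ (i j : Fin n) → i ≢ j →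
  Fixed (λ x → coord i x ℤ.* coord j x) p → Fixed (coord i) p × Fixed (coord j) p

sq : ℤ → ℤ
sq k = k ℤ.* k

Small : ℤ → Set
Small k = k ≡ + 0 ⊎ PM k

small-square : ∀ {k} → Small k → sq k ℤ.≤ + 1
small-square (inj₁ refl) = ℤ.+≤+ ℕ.z≤n
small-square (inj₂ pm)   = ℤP.≤-reflexive (pm-square pm)

sum-small : (d : Vector ℤ n) (Q : Fin n → Set) → (∀ i → d i ≡ + 0 ⊎ (Q i × Small (d i))) →
  (∀ i j → i ≢ j → Q i → Q j → ⊥) → Small (sum d)
sum-small {zero}  d Q h unique = inj₁ refl
sum-small {suc n} d Q h unique with h zero
... | inj₁ d₀≡0 =
  subst Small (trans (sym (ℤP.+-identityˡ _)) (cong (ℤ._+ sum (d ∘ suc)) (sym d₀≡0)))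
    (sum-small (d ∘ suc) (Q ∘ suc) (h ∘ suc)
      (λ i j i≢j → unique (suc i) (suc j) (i≢j ∘ FinP.suc-injective)))
... | inj₂ (q₀ , small₀) =
  subst Small (sym (trans (cong (λ r → d zero ℤ.+ r) rest≡0) (ℤP.+-identityʳ (d zero)))) small₀
  where
  rest-zero : ∀ i → d (suc i) ≡ + 0
  rest-zero i with h (suc i)
  ... | inj₁ e        = e
  ... | inj₂ (qᵢ , _) = ⊥-elim (unique zero (suc i) (λ ()) q₀ qᵢ)
  rest≡0 : sum (d ∘ suc) ≡ + 0
  rest≡0 = trans (sum-cong-≗ rest-zero) (sum-replicate-zero n)

sum-difference : (f g : Vector ℤ n) → sum (λ i → f i ℤ.- g i) ≡ sum f ℤ.- sum g
sum-difference {zero}  f g = refl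
sum-difference {suc n} f g rewrite sum-difference (f ∘ suc) (g ∘ suc) =
  solve 4 (λ a b c d → (a :- b) :+ (c :- d) := (a :+ c) :- (b :+ d)) refl
    (f zero) (g zero) (sum (f ∘ suc)) (sum (g ∘ suc))

val-not² : ∀ a b → val (not a) ℤ.* val (not b) ≡ val a ℤ.* val b
val-not² true  true  = refl
val-not² true  false = refl
val-not² false true  = refl
val-not² false false = refl

module OneQuery {n} (p : List (Query n)) (S : Subset n) (b : ℤ) {u : Cube n}
                (fu : Follows u (extend p S b)) where

  q : List (Query n)
  q = extend p S b

  -- Followers of p on the other side of χ_S agree on every coordinate constant on q:
  -- v·m·u lies on q's side, so its i-th coordinate equals u's.
  opposite-agree : ∀ {i a} → ConstOn q i a → ∀ {v m} → Follows v p → chi S v ≢ b →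
    Follows m p → chi S m ≢ b → lookup v i ≡ lookup m i
  opposite-agree {i} h {v} {m} fv v≢b fm m≢b = ⊙-cancel (lookup v i) (lookup m i) (lookup u i) agree
    where
    open ≡-Reasoning
    u-answer : chi S u ≡ b
    u-answer = follows-answer p S b fu
    same-side : chi S v ≡ chi S m
    same-side = pm-other (chi-pm S v) (chi-pm S m) (chi-pm S u)
                  (v≢b ∘ (λ e → trans e u-answer)) (m≢b ∘ (λ e → trans e u-answer))
    t : Cube n
    t = v · (m · u)
    ft : Follows t q
    ft = follows-extend p S b (coset p fv fm (follows-prefix p S b fu))
           (trans (chi-same-side S v m u same-side) u-answer)
    agree : lookup v i ⊙ (lookup m i ⊙ lookup u i) ≡ lookup u i
    agree = begin
      lookup v i ⊙ (lookup m i ⊙ lookup u i)  ≡⟨ cong (lookup v i ⊙_) (sym (lookup-· m u i)) ⟩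
      lookup v i ⊙ lookup (m · u) i           ≡⟨ sym (lookup-· v (m · u) i) ⟩
      lookup t i                              ≡⟨ trans (h t ft) (sym (h u fu)) ⟩
      lookup u i                              ∎

  opposite-flipped : ∀ {i a} → Mixed p i → ConstOn q i a → ∀ {v} → Follows v p → chi S v ≢ b →
    lookup v i ≡ not a
  opposite-flipped {i} {a} mixedᵢ h fv v≢b with mixedᵢ (not a)
  ... | m , fm , m≡¬a = trans (opposite-agree h fv v≢b fm m≢b) m≡¬a
    where
    m≢b : chi S m ≢ b
    m≢b e = not-¬ refl (trans (sym (h m (follows-extend p S b fm e))) m≡¬a)

  NewlyFixed : Fin n → Set
  NewlyFixed i = Mixed p i × Σ Bool (ConstOn q i)

  -- At most one coordinate is newly fixed: if x_i and x_j both were, x_i x_j would be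
  -- fixed on p, so correlation-freeness would fix x_i on p, contradicting mixedness.
  newly-fixed-unique : CorrelationFreeAt p → ∀ i j → i ≢ j → NewlyFixed i → NewlyFixed j → ⊥
  newly-fixed-unique cf i j i≢j (mixedᵢ , a , hᵢ) (mixedⱼ , a' , hⱼ)
    with mixedᵢ true | mixedᵢ false
  ... | y , fy , y≡1 | z , fz , z≡-1 = -1≢1 (begin
      -[1+ 0 ]    ≡⟨ cong val (sym z≡-1) ⟩
      coord i z   ≡⟨ xᵢ-fixed z y fz fy ⟩
      coord i y   ≡⟨ cong val y≡1 ⟩
      + 1         ∎)
    where
    open ≡-Reasoning
    product : ∀ v → Follows v p → coord i v ℤ.* coord j v ≡ val a ℤ.* val a'
    product v fv with chi S v ℤ.≟ b
    ... | yes e = cong₂ (λ s t → val s ℤ.* val t) (hᵢ v (follows-extend p S b fv e))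
                                                  (hⱼ v (follows-extend p S b fv e))
    ... | no ne rewrite opposite-flipped mixedᵢ hᵢ fv ne | opposite-flipped mixedⱼ hⱼ fv ne =
      val-not² a a'
    xᵢ-fixed : Fixed (coord i) p
    xᵢ-fixed = proj₁ (cf i j i≢j (λ v w fv fw → trans (product v fv) (sym (product w fw))))

  change : ∀ i (w : View p i) (w' : View q i) →
    cval w' ℤ.- cval w ≡ + 0 ⊎ (NewlyFixed i × Small (cval w' ℤ.- cval w))
  change i (const a h) w' = inj₁ (trans
    (cong (ℤ._- val a) (cval-const q i (λ y fy → h y (follows-prefix p S b fy)) fu w'))
    (ℤP.+-inverseʳ (val a)))
  change i (mixed m) (const a h) =
    inj₂ ((m , a , h) , inj₂ (subst PM (sym (ℤP.+-identityʳ (val a))) (val-pm a)))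
  change i (mixed m) (mixed _) = inj₁ refl

  deviation : CorrelationFreeAt p → sq (G q ℤ.- G p) ℤ.≤ + 1
  deviation cf = small-square (subst Small (sum-difference (c q) (c p))
    (sum-small (λ i → c q i ℤ.- c p i) NewlyFixed (λ i → change i (view p i) (view q i))
               (newly-fixed-unique cf)))

parallel-axis : ∀ A B X Y g → A ℤ.* X ℤ.+ B ℤ.* Y ≡ (A ℤ.+ B) ℤ.* g →
  A ℤ.* sq X ℤ.+ B ℤ.* sq Y ≡ (A ℤ.+ B) ℤ.* sq g ℤ.+ (A ℤ.* sq (X ℤ.- g) ℤ.+ B ℤ.* sq (Y ℤ.- g))
parallel-axis A B X Y g mean = begin
  A ℤ.* sq X ℤ.+ B ℤ.* sq Y
    ≡⟨ solve 5 (λ A B X Y g → A :* (X :* X) :+ B :* (Y :* Y)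
                 := ((A :+ B) :* (g :* g) :+ (A :* ((X :- g) :* (X :- g)) :+ B :* ((Y :- g) :* (Y :- g))))
                    :+ (g :+ g) :* ((A :* X :+ B :* Y) :- (A :+ B) :* g)) refl A B X Y g ⟩
  rhs ℤ.+ (g ℤ.+ g) ℤ.* ((A ℤ.* X ℤ.+ B ℤ.* Y) ℤ.- (A ℤ.+ B) ℤ.* g)
    ≡⟨ cong (λ t → rhs ℤ.+ (g ℤ.+ g) ℤ.* (t ℤ.- (A ℤ.+ B) ℤ.* g)) mean ⟩
  rhs ℤ.+ (g ℤ.+ g) ℤ.* ((A ℤ.+ B) ℤ.* g ℤ.- (A ℤ.+ B) ℤ.* g)
    ≡⟨ solve 3 (λ r g m → r :+ (g :+ g) :* (m :- m) := r) refl rhs g ((A ℤ.+ B) ℤ.* g) ⟩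
  rhs ∎
  where
  open ≡-Reasoning
  rhs = (A ℤ.+ B) ℤ.* sq g ℤ.+ (A ℤ.* sq (X ℤ.- g) ℤ.+ B ℤ.* sq (Y ℤ.- g))

split-energy : (p : List (Query n)) (S : Subset n) → CorrelationFreeAt p →
  N (extend p S -[1+ 0 ]) ℤ.* sq (G (extend p S -[1+ 0 ])) ℤ.+ N (extend p S (+ 1)) ℤ.* sq (G (extend p S (+ 1)))
    ℤ.≤ N p ℤ.* (sq (G p) ℤ.+ + 1)
split-energy p S cf = begin
  A ℤ.* sq X ℤ.+ B ℤ.* sq Y
    ≡⟨ parallel-axis A B X Y g mean ⟩
  (A ℤ.+ B) ℤ.* sq g ℤ.+ (A ℤ.* sq (X ℤ.- g) ℤ.+ B ℤ.* sq (Y ℤ.- g))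
    ≤⟨ ℤP.+-monoʳ-≤ ((A ℤ.+ B) ℤ.* sq g) (ℤP.+-mono-≤ (near -[1+ 0 ]) (near (+ 1))) ⟩
  (A ℤ.+ B) ℤ.* sq g ℤ.+ (A ℤ.+ B)
    ≡⟨ solve 2 (λ K g² → K :* g² :+ K := K :* (g² :+ con (+ 1))) refl (A ℤ.+ B) (sq g) ⟩
  (A ℤ.+ B) ℤ.* (sq g ℤ.+ + 1)
    ≡⟨ cong (ℤ._* (sq g ℤ.+ + 1)) (sym (N-split p S)) ⟩
  N p ℤ.* (sq g ℤ.+ + 1) ∎
  where
  open ℤP.≤-Reasoning
  A = N (extend p S -[1+ 0 ])
  B = N (extend p S (+ 1))
  X = G (extend p S -[1+ 0 ])
  Y = G (extend p S (+ 1))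
  g = G p
  mean : A ℤ.* X ℤ.+ B ℤ.* Y ≡ (A ℤ.+ B) ℤ.* g
  mean = trans (sym (G-martingale p S)) (cong (ℤ._* g) (N-split p S))
  near : ∀ v → N (extend p S v) ℤ.* sq (G (extend p S v) ℤ.- g) ℤ.≤ N (extend p S v)
  near v = N-weighted-bound (extend p S v) _ (λ u fu → OneQuery.deviation p S v fu cf)

CorrelationFreeBelow : PDT n → List (Query n) → Set
CorrelationFreeBelow {n} t p = ∀ (i j : Fin n) → i ≢ j → ∀ r → IsPath t r →
  Fixed (λ x → coord i x ℤ.* coord j x) (p ++ r) → Fixed (coord i) (p ++ r) × Fixed (coord j) (p ++ r)

below⇒at : (t : PDT n) (p : List (Query n)) → CorrelationFreeBelow t p → CorrelationFreeAt p
below⇒at t p cf i j i≢j fixed = subst (λ r → Fixed (coord i) r × Fixed (coord j) r) (ListP.++-identityʳ p)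
  (cf i j i≢j [] here (subst (Fixed (λ x → coord i x ℤ.* coord j x)) (sym (ListP.++-identityʳ p)) fixed))

below-child : {S : Subset n} {t₋ t₊ t : PDT n} (p : List (Query n)) (v : ℤ) →
  (∀ {r} → IsPath t r → IsPath (node S t₋ t₊) ((S , v) ∷ r)) →
  CorrelationFreeBelow (node S t₋ t₊) p → CorrelationFreeBelow t (extend p S v)
below-child {S = S} p v step cf i j i≢j r path fixed =
  subst (λ r' → Fixed (coord i) r' × Fixed (coord j) r') (sym assoc)
    (cf i j i≢j ((S , v) ∷ r) (step path) (subst (Fixed (λ x → coord i x ℤ.* coord j x)) assoc fixed))
  where assoc = ListP.++-assoc p [ S , v ] r

energy : PDT n → List (Query n) → ℤ
energy leaf           p = N p ℤ.* sq (G p)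
energy (node S t₋ t₊) p = energy t₋ (extend p S -[1+ 0 ]) ℤ.+ energy t₊ (extend p S (+ 1))

route : (p : List (Query n)) (S : Subset n) (t₋ t₊ : PDT n) (F : List (Query n) → ℤ) (x : Cube n) →
  ind p x ℤ.* F (p ++ pathOf (node S t₋ t₊) x) ≡
  ind (extend p S -[1+ 0 ]) x ℤ.* F (extend p S -[1+ 0 ] ++ pathOf t₋ x) ℤ.+
  ind (extend p S (+ 1)) x ℤ.* F (extend p S (+ 1) ++ pathOf t₊ x)
route p S t₋ t₊ F x with chi S x ℤ.≟ -[1+ 0 ]
... | yes e rewrite ind-extend-yes p S -[1+ 0 ] x e
                  | ind-extend-no p S (+ 1) x (λ e' → -1≢1 (trans (sym e) e'))
                  | ListP.++-assoc p [ S , -[1+ 0 ] ] (pathOf t₋ x) = sym (ℤP.+-identityʳ _)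
... | no ne with chi-pm S x
...   | inj₂ e = ⊥-elim (ne e)
...   | inj₁ e rewrite ind-extend-yes p S (+ 1) x e
                     | ind-extend-no p S -[1+ 0 ] x (λ e' → -1≢1 (trans (sym e') e))
                     | ListP.++-assoc p [ S , + 1 ] (pathOf t₊ x) = sym (ℤP.+-identityˡ _)

energy-as-sum : (t : PDT n) (p : List (Query n)) →
  sumAll (λ x → ind p x ℤ.* sq (G (p ++ pathOf t x))) ≡ energy t p
energy-as-sum leaf p = trans
  (sumAll-cong (λ x → cong (λ r → ind p x ℤ.* sq (G r)) (ListP.++-identityʳ p)))
  (sumAll-*c (ind p) (sq (G p)))
energy-as-sum (node S t₋ t₊) p = begin
  sumAll (λ x → ind p x ℤ.* sq (G (p ++ pathOf (node S t₋ t₊) x)))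
    ≡⟨ sumAll-cong (route p S t₋ t₊ (sq ∘ G)) ⟩
  sumAll (λ x → F₋ x ℤ.+ F₊ x)
    ≡⟨ sumAll-+ F₋ F₊ ⟩
  sumAll F₋ ℤ.+ sumAll F₊
    ≡⟨ cong₂ ℤ._+_ (energy-as-sum t₋ (extend p S -[1+ 0 ])) (energy-as-sum t₊ (extend p S (+ 1))) ⟩
  energy (node S t₋ t₊) p ∎
  where
  open ≡-Reasoning
  F₋ = λ x → ind (extend p S -[1+ 0 ]) x ℤ.* sq (G (extend p S -[1+ 0 ] ++ pathOf t₋ x))
  F₊ = λ x → ind (extend p S (+ 1)) x ℤ.* sq (G (extend p S (+ 1) ++ pathOf t₊ x))

scale : ∀ k {l m} → + 0 ℤ.≤ k → l ℤ.≤ m → k ℤ.* l ℤ.≤ k ℤ.* m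
scale k 0≤k = ℤP.*-monoˡ-≤-nonNeg k {{ℤ.nonNegative 0≤k}}

energy-bound : (t : PDT n) (p : List (Query n)) → CorrelationFreeBelow t p →
  energy t p ℤ.≤ N p ℤ.* (sq (G p) ℤ.+ + depth t)
energy-bound leaf p _ = ℤP.≤-reflexive (cong (N p ℤ.*_) (sym (ℤP.+-identityʳ (sq (G p)))))
energy-bound (node S t₋ t₊) p cf = begin
  energy t₋ p₋ ℤ.+ energy t₊ p₊
    ≤⟨ ℤP.+-mono-≤ (energy-bound t₋ p₋ (below-child p -[1+ 0 ] left cf))
                   (energy-bound t₊ p₊ (below-child p (+ 1) right cf)) ⟩
  A ℤ.* (sq X ℤ.+ + d₋) ℤ.+ B ℤ.* (sq Y ℤ.+ + d₊)
    ≤⟨ ℤP.+-mono-≤ (scale A (N-nonneg p₋) (ℤP.+-monoʳ-≤ (sq X) (ℤ.+≤+ (ℕP.m≤m⊔n d₋ d₊))))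
                   (scale B (N-nonneg p₊) (ℤP.+-monoʳ-≤ (sq Y) (ℤ.+≤+ (ℕP.m≤n⊔m d₋ d₊)))) ⟩
  A ℤ.* (sq X ℤ.+ + M) ℤ.+ B ℤ.* (sq Y ℤ.+ + M)
    ≡⟨ solve 5 (λ A B X² Y² M → A :* (X² :+ M) :+ B :* (Y² :+ M) := (A :* X² :+ B :* Y²) :+ (A :+ B) :* M)
         refl A B (sq X) (sq Y) (+ M) ⟩
  (A ℤ.* sq X ℤ.+ B ℤ.* sq Y) ℤ.+ (A ℤ.+ B) ℤ.* + M
    ≤⟨ ℤP.+-mono-≤ (split-energy p S (below⇒at (node S t₋ t₊) p cf))
                   (ℤP.≤-reflexive (cong (ℤ._* + M) (sym (N-split p S)))) ⟩
  N p ℤ.* (sq g ℤ.+ + 1) ℤ.+ N p ℤ.* + M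
    ≡⟨ solve 3 (λ K g² M → K :* (g² :+ con (+ 1)) :+ K :* M := K :* (g² :+ (con (+ 1) :+ M)))
         refl (N p) (sq g) (+ M) ⟩
  N p ℤ.* (sq g ℤ.+ + suc M) ∎
  where
  open ℤP.≤-Reasoning
  p₋ = extend p S -[1+ 0 ]
  p₊ = extend p S (+ 1)
  A = N p₋
  B = N p₊
  X = G p₋
  Y = G p₊
  g = G p
  d₋ = depth t₋
  d₊ = depth t₊
  M = d₋ ℕ.⊔ d₊

-- Transfer from integer sums to rational averages.

ι : ℤ → ℚ
ι k = k / 1

ι-unnormalised : ∀ k → toℚᵘ (ι k) ℚᵘ.≃ mkℚᵘ k 0
ι-unnormalised k = ℚP.toℚᵘ-fromℚᵘ (mkℚᵘ k 0)

ι-+ : ∀ k l → ι (k ℤ.+ l) ≡ ι k ℚ.+ ι l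
ι-+ k l = ℚP.toℚᵘ-injective (begin
  toℚᵘ (ι (k ℤ.+ l))          ≈⟨ ι-unnormalised (k ℤ.+ l) ⟩
  mkℚᵘ (k ℤ.+ l) 0            ≈⟨ *≡* (solve 2 (λ k l → (k :+ l) :* (con (+ 1) :* con (+ 1))
                                               := ((k :* con (+ 1)) :+ (l :* con (+ 1))) :* con (+ 1)) refl k l) ⟩
  mkℚᵘ k 0 ℚᵘ.+ mkℚᵘ l 0      ≈⟨ ℚᵘP.≃-sym (ℚᵘP.+-cong (ι-unnormalised k) (ι-unnormalised l)) ⟩
  toℚᵘ (ι k) ℚᵘ.+ toℚᵘ (ι l)  ≈⟨ ℚᵘP.≃-sym (ℚP.toℚᵘ-homo-+ (ι k) (ι l)) ⟩
  toℚᵘ (ι k ℚ.+ ι l)          ∎)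
  where open ℚᵘP.≃-Reasoning

ι-* : ∀ k l → ι (k ℤ.* l) ≡ ι k ℚ.* ι l
ι-* k l = ℚP.toℚᵘ-injective (begin
  toℚᵘ (ι (k ℤ.* l))          ≈⟨ ι-unnormalised (k ℤ.* l) ⟩
  mkℚᵘ (k ℤ.* l) 0            ≈⟨ *≡* (solve 2 (λ k l → (k :* l) :* (con (+ 1) :* con (+ 1))
                                               := (k :* l) :* con (+ 1)) refl k l) ⟩
  mkℚᵘ k 0 ℚᵘ.* mkℚᵘ l 0      ≈⟨ ℚᵘP.≃-sym (ℚᵘP.*-cong (ι-unnormalised k) (ι-unnormalised l)) ⟩
  toℚᵘ (ι k) ℚᵘ.* toℚᵘ (ι l)  ≈⟨ ℚᵘP.≃-sym (ℚP.toℚᵘ-homo-* (ι k) (ι l)) ⟩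
  toℚᵘ (ι k ℚ.* ι l)          ∎)
  where open ℚᵘP.≃-Reasoning

ι-0 : ι (+ 0) ≡ 0ℚ
ι-0 = ℚP.0/n≡0 1

ι-mono : ∀ {k l} → k ℤ.≤ l → ι k ℚ.≤ ι l
ι-mono {k} {l} k≤l = ℚP.toℚᵘ-cancel-≤
  (ℚᵘP.≤-respʳ-≃ (ℚᵘP.≃-sym (ι-unnormalised l)) (ℚᵘP.≤-respˡ-≃ (ℚᵘP.≃-sym (ι-unnormalised k))
    (*≤* (ℤP.*-monoʳ-≤-nonNeg (+ 1) k≤l))))

cancel-length : ∀ m D → ι (+ suc m ℤ.* D) ℚ.* (+ 1 / suc m) ≡ ι D
cancel-length m D = ℚP.toℚᵘ-injective (begin
  toℚᵘ (ι (K ℤ.* D) ℚ.* (+ 1 / suc m))          ≈⟨ ℚP.toℚᵘ-homo-* (ι (K ℤ.* D)) (+ 1 / suc m) ⟩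
  toℚᵘ (ι (K ℤ.* D)) ℚᵘ.* toℚᵘ (+ 1 / suc m)    ≈⟨ ℚᵘP.*-cong (ι-unnormalised (K ℤ.* D))
                                                                (ℚP.toℚᵘ-fromℚᵘ (mkℚᵘ (+ 1) m)) ⟩
  mkℚᵘ (K ℤ.* D) 0 ℚᵘ.* mkℚᵘ (+ 1) m            ≈⟨ *≡* (solve 2 (λ K D → ((K :* D) :* con (+ 1)) :* con (+ 1)
                                                                    := D :* (con (+ 1) :* K)) refl K D) ⟩
  mkℚᵘ D 0                                      ≈⟨ ℚᵘP.≃-sym (ι-unnormalised D) ⟩
  toℚᵘ (ι D)                                    ∎)
  where
  open ℚᵘP.≃-Reasoning
  K = + suc m

sumL : {A : Set} → List A → (A → ℤ) → ℤ
sumL []       g = + 0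
sumL (y ∷ ys) g = g y ℤ.+ sumL ys g

sumℚ-map : {A : Set} (L : List A) (h : A → ℚ) (g : A → ℤ) → (∀ y → h y ≡ ι (g y)) →
  sumℚ (map h L) ≡ ι (sumL L g)
sumℚ-map []       h g e = sym ι-0
sumℚ-map (y ∷ ys) h g e = trans (cong₂ ℚ._+_ (e y) (sumℚ-map ys h g e)) (sym (ι-+ (g y) (sumL ys g)))

avg-cons : {A : Set} (y : A) (ys : List A) (h : A → ℚ) (g : A → ℤ) → (∀ y → h y ≡ ι (g y)) →
  avg (map h (y ∷ ys)) ≡ ι (sumL (y ∷ ys) g) ℚ.* (+ 1 / suc (length ys))
avg-cons y ys h g e rewrite ListP.length-map h ys = cong (ℚ._* (+ 1 / suc (length ys))) (sumℚ-map (y ∷ ys) h g e)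

avg-exact : {A : Set} (L : List A) (g : A → ℤ) (k : ℤ) → 1 ℕ.≤ length L →
  sumL L g ≡ + length L ℤ.* k → avg (map (ι ∘ g) L) ≡ ι k
avg-exact (y ∷ ys) g k _ total = begin
  avg (map (ι ∘ g) (y ∷ ys))                             ≡⟨ avg-cons y ys (ι ∘ g) g (λ _ → refl) ⟩
  ι (sumL (y ∷ ys) g) ℚ.* (+ 1 / suc (length ys))        ≡⟨ cong (λ t → ι t ℚ.* (+ 1 / suc (length ys))) total ⟩
  ι (+ suc (length ys) ℤ.* k) ℚ.* (+ 1 / suc (length ys)) ≡⟨ cancel-length (length ys) k ⟩
  ι k                                                    ∎
  where open ≡-Reasoning

avg-bound : {A : Set} (L : List A) (h : A → ℚ) (g : A → ℤ) (D : ℤ) → (∀ y → h y ≡ ι (g y)) →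
  sumL L g ℤ.≤ + length L ℤ.* D → + 0 ℤ.≤ D → avg (map h L) ℚ.≤ ι D
avg-bound []       h g D e _ 0≤D = subst (ℚ._≤ ι D) ι-0 (ι-mono 0≤D)
avg-bound (y ∷ ys) h g D e total _ = begin
  avg (map h (y ∷ ys))                      ≡⟨ avg-cons y ys h g e ⟩
  ι (sumL (y ∷ ys) g) ℚ.* r                 ≤⟨ ℚP.*-monoʳ-≤-nonNeg r {{ℚP.normalize-nonNeg 1 (suc (length ys))}}
                                                 (ι-mono total) ⟩
  ι (+ suc (length ys) ℤ.* D) ℚ.* r         ≡⟨ cancel-length (length ys) D ⟩
  ι D                                       ∎
  where
  open ℚP.≤-Reasoning
  r = + 1 / suc (length ys)

sumL-filter : (p : List (Query n)) (xs : List (Cube n)) (f : Cube n → ℤ) →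
  sumL (filter (follows? p) xs) f ≡ sumL xs (λ y → ind p y ℤ.* f y)
sumL-filter p []       f = refl
sumL-filter p (y ∷ xs) f with follows? p y
... | yes _ = cong₂ ℤ._+_ (sym (ℤP.*-identityˡ (f y))) (sumL-filter p xs f)
... | no _  = trans (sumL-filter p xs f) (sym (ℤP.+-identityˡ _))

length-filter : (p : List (Query n)) (xs : List (Cube n)) →
  + length (filter (follows? p) xs) ≡ sumL xs (ind p)
length-filter p []       = refl
length-filter p (y ∷ xs) with follows? p y
... | yes _ = cong (λ k → + 1 ℤ.+ k) (length-filter p xs)
... | no _  = trans (length-filter p xs) (sym (ℤP.+-identityˡ _))

sumL-allCubes : (n : ℕ) (f : Cube n → ℤ) → sumL (allCubes n) f ≡ sumAll f
sumL-allCubes zero    f = ℤP.+-identityʳ (f [])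
sumL-allCubes (suc n) f = trans (sumL-doubled (allCubes n)) (sumL-allCubes n _)
  where
  sumL-doubled : (xs : List (Cube n)) →
    sumL (concatMap (λ x → (true ∷ x) ∷ (false ∷ x) ∷ []) xs) f
      ≡ sumL xs (λ x → f (true ∷ x) ℤ.+ f (false ∷ x))
  sumL-doubled []       = refl
  sumL-doubled (x ∷ xs) rewrite sumL-doubled xs = sym (ℤP.+-assoc (f (true ∷ x)) (f (false ∷ x)) _)

sum-inputsOn : (p : List (Query n)) (f : Cube n → ℤ) →
  sumL (inputsOn p) f ≡ sumAll (λ y → ind p y ℤ.* f y)
sum-inputsOn {n} p f = trans (sumL-filter p (allCubes n) f) (sumL-allCubes n _)

count-inputsOn : (p : List (Query n)) → + length (inputsOn p) ≡ N p
count-inputsOn {n} p = trans (length-filter p (allCubes n)) (sumL-allCubes n (ind p))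

leaf-entry : (p : List (Query n)) (x : Cube n) → Follows x p → (i : Fin n) →
  avg (map (λ y → coord i y / 1) (inputsOn p)) ≡ ι (c p i)
leaf-entry p x fx i = avg-exact (inputsOn p) (coord i) (c p i) nonempty (begin
  sumL (inputsOn p) (coord i)            ≡⟨ sum-inputsOn p (coord i) ⟩
  Sc p i                                 ≡⟨ Sc≡N*c p i ⟩
  N p ℤ.* c p i                          ≡⟨ cong (ℤ._* c p i) (sym (count-inputsOn p)) ⟩
  + length (inputsOn p) ℤ.* c p i        ∎)
  where
  open ≡-Reasoning
  nonempty : 1 ℕ.≤ length (inputsOn p)
  nonempty = ℤP.drop‿+≤+ (subst (+ 1 ℤ.≤_) (sym (count-inputsOn p)) (N-positive p x fx))

follows-path : (t : PDT n) (x : Cube n) → Follows x (pathOf t x)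
follows-path leaf           x = []
follows-path (node S t₋ t₊) x with chi S x ℤ.≟ -[1+ 0 ]
... | yes e = e ∷ follows-path t₋ x
... | no ne with chi-pm S x
...   | inj₁ e = e ∷ follows-path t₊ x
...   | inj₂ e = ⊥-elim (ne e)

foldr-tabulate : (f : Fin n → ℚ) (g : Vector ℤ n) → (∀ i → f i ≡ ι (g i)) →
  Vec.foldr (λ _ → ℚ) ℚ._+_ 0ℚ (Vec.tabulate f) ≡ ι (sum g)
foldr-tabulate {zero}  f g e = sym ι-0
foldr-tabulate {suc n} f g e = trans
  (cong₂ ℚ._+_ (e zero) (foldr-tabulate (f ∘ suc) (g ∘ suc) (e ∘ suc)))
  (sym (ι-+ (g zero) (sum (g ∘ suc))))

leaf-sum : (T : PDT n) (x : Cube n) → Vec.foldr (λ _ → ℚ) ℚ._+_ 0ℚ (leafVec T x) ≡ ι (G (pathOf T x))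
leaf-sum T x = foldr-tabulate _ (c (pathOf T x)) (leaf-entry (pathOf T x) x (follows-path T x))

inputsOn-root : inputsOn {n} [] ≡ allCubes n
inputsOn-root {n} = ListP.filter-all (follows? []) (All.universal (λ _ → []) (allCubes n))

-- Every coordinate is mixed at the root, so G [] = 0.
G-root : G {n} [] ≡ + 0
G-root {n} = trans (sum-cong-≗ (λ i → cval-mixed [] i (root-mixed i) (view [] i))) (sum-replicate-zero n)
  where
  root-mixed : ∀ i → Mixed [] i
  root-mixed i a = replicate n a , [] , VecP.lookup-replicate i a

-- The expectation is the average over x of G (pathOf T x)², and the total energy of T at
-- the root is at most 2ⁿ (G(root)² + depth T) = 2ⁿ · depth T.
proposition4 : (n d : ℕ) (T : PDT n) → CorrelationFree T → depth T ≡ d →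
    expSqSum T ≤ (+ d / 1)
proposition4 n d T cf refl =
  avg-bound (allCubes n) _ leafEnergy (+ depth T) squared-leaf-sum total (ℤ.+≤+ ℕ.z≤n)
  where
  root : List (Query n)
  root = []
  leafEnergy : Cube n → ℤ
  leafEnergy x = sq (G (pathOf T x))
  squared-leaf-sum : ∀ x → (let s = Vec.foldr _ ℚ._+_ 0ℚ (leafVec T x) in s ℚ.* s) ≡ ι (leafEnergy x)
  squared-leaf-sum x =
    trans (cong₂ ℚ._*_ (leaf-sum T x) (leaf-sum T x)) (sym (ι-* (G (pathOf T x)) (G (pathOf T x))))
  total : sumL (allCubes n) leafEnergy ℤ.≤ + length (allCubes n) ℤ.* + depth T
  total = begin
    sumL (allCubes n) leafEnergy                ≡⟨ cong (λ L → sumL L leafEnergy) (sym (inputsOn-root {n})) ⟩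
    sumL (inputsOn root) leafEnergy             ≡⟨ sum-inputsOn root leafEnergy ⟩
    sumAll (λ x → ind root x ℤ.* leafEnergy x)  ≡⟨ energy-as-sum T root ⟩
    energy T root                               ≤⟨ energy-bound T root cf ⟩
    N root ℤ.* (sq (G root) ℤ.+ + depth T)      ≡⟨ cong₂ (λ N₀ G₀ → N₀ ℤ.* (sq G₀ ℤ.+ + depth T))
                                                         (sym (count-inputsOn root)) (G-root {n}) ⟩
    + length (inputsOn root) ℤ.* + depth T      ≡⟨ cong (λ L → + length L ℤ.* + depth T) (inputsOn-root {n}) ⟩
    + length (allCubes n) ℤ.* + depth T         ∎
    where open ℤP.≤-Reasoning
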